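{- Let $1\le r\le n/2$ and let $\mathcal{F}\subseteq\binom{[n]}{r}$ be shifted and intersecting. For any set $S\subseteq[n]$ let $\kappa_S$ be the largest nonnegative integer $\kappa$ with $2\kappa\le n$ and $|S\cap[2\kappa]|=\kappa$, and for $F\in\mathcal{F}$ define $\phi(F)=F$ if $1\in F$ and $\phi(F)=F\,\triangle\,[2\kappa_F]$ if $1\notin F$; let $\phi(\mathcal{F})=\{\phi(F):F\in\mathcal{F}\}$. If $B\in\phi(\mathcal{F})\setminus\mathcal{F}$, then the (unique) $A\in\mathcal{F}$ with $\phi(A)=B$ is $A=B\,\triangle\,[2\kappa_B]$.
   Context: $[m]=\{1,\dots,m\}$ (with $[0]=\emptyset$), $\binom{X}{r}$ is the family of $r$-element subsets of $X$, and $\triangle$ is symmetric difference. A family is intersecting if any two of its members intersect. For $i,j\in[n]$ and $A\subseteq[n]$, $\sigma_{i,j}(A)=(A\setminus\{i\})\cup\{j\}$ if $i\in A$, $j\notin A$, and $\sigma_{i,j}(A)=A$ otherwise; for a family $\mathcal{F}$, $\sigma_{i,j}(\mathcal{F})=\{\sigma'_{i,j}(A):A\in\mathcal{F}\}$ where $\sigma'_{i,j}(A)=\sigma_{i,j}(A)$ if $\sigma_{i,j}(A)\notin\mathcal{F}$ and $\sigma'_{i,j}(A)=A$ otherwise. $\mathcal{F}\subseteq\binom{[n]}{r}$ is shifted if $\sigma_{i,j}(\mathcal{F})=\mathcal{F}$ for all $1\le j<i\le n$. (The map $\phi$ is injective on such $\mathcal{F}$.) -}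

module Defs where

open import Data.Nat using (ℕ; zero; suc; _*_; _<ᵇ_; _≡ᵇ_; _/_)
open import Data.Bool using (Bool; true; false; if_then_else_; _xor_)
open import Data.Fin using (Fin; toℕ; _<_) renaming (zero to fzero)
open import Data.Fin.Subset using (Subset; _∩_; ∣_∣; _∈_; Nonempty)
open import Data.Vec using (tabulate; zipWith; lookup; _[_]≔_)
open import Data.Product using (Σ; _×_)
open import Relation.Binary.PropositionalEquality using (_≡_)
open import Relation.Nullary using (¬_)

-- The ground set [n] = {1,…,n} is modelled by Fin n, with element i ↔ i+1.
-- A family of subsets of [n] is a predicate on Subset n.
Family : ℕ → Set₁
Family n = Subset n → Set

-- [m] ∩ [n] : the first m elements (indices 0,…,m-1, i.e. {1,…,m})
prefix : ∀ {n} → ℕ → Subset n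
prefix m = tabulate (λ i → toℕ i <ᵇ m)

_△_ : ∀ {n} → Subset n → Subset n → Subset n
A △ B = zipWith _xor_ A B

-- search for the largest κ ≤ k with |S ∩ [2κ]| = κ (κ = 0 always qualifies)
kappaFrom : ∀ {n} → Subset n → ℕ → ℕ
kappaFrom S zero = zero
kappaFrom S (suc k) =
  if ∣ S ∩ prefix (2 * suc k) ∣ ≡ᵇ suc k then suc k else kappaFrom S k

kappa : ∀ {n} → Subset n → ℕ
kappa {n} S = kappaFrom S (n / 2)

-- φ(F) = F if 1 ∈ F, and F △ [2κ_F] otherwise (1 is index 0 of Fin (suc m))
phi : ∀ {m} → Subset (suc m) → Subset (suc m)
phi F = if lookup F fzero then F else F △ prefix (2 * kappa F)

σ : ∀ {n} → Fin n → Fin n → Subset n → Subset n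
σ i j A = if lookup A i then (if lookup A j then A else ((A [ i ]≔ false) [ j ]≔ true)) else A

σ'Rel : ∀ {n} → Family n → Fin n → Fin n → Subset n → Subset n → Set
σ'Rel 𝓕 i j A B = (𝓕 (σ i j A) → B ≡ A) × (¬ 𝓕 (σ i j A) → B ≡ σ i j A)

σFam : ∀ {n} → Family n → Fin n → Fin n → Family n
σFam 𝓕 i j B = Σ (Subset _) (λ A → 𝓕 A × σ'Rel 𝓕 i j A B)

_≐_ : ∀ {n} → Family n → Family n → Set
𝓐 ≐ 𝓑 = ∀ B → (𝓐 B → 𝓑 B) × (𝓑 B → 𝓐 B)

Shifted : ∀ {n} → Family n → Set
Shifted {n} 𝓕 = (i j : Fin n) → j < i → σFam 𝓕 i j ≐ 𝓕

Intersecting : ∀ {n} → Family n → Set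
Intersecting 𝓕 = ∀ A B → 𝓕 A → 𝓕 B → Nonempty (A ∩ B)

Uniform : ∀ {n} → ℕ → Family n → Set
Uniform r 𝓕 = ∀ A → 𝓕 A → ∣ A ∣ ≡ r

module Submission where

open import Defs
open import Data.Nat using (ℕ; zero; suc; _≤_; _*_; _+_; _/_; _≡ᵇ_; z≤n; s≤s)
open import Data.Nat.Properties
open import Data.Nat.DivMod using (m/n*n≤m)
open import Data.Bool using (true; false; _xor_; if_then_else_)
open import Data.Bool.Properties using (xor-assoc; xor-same; xor-identityʳ)
open import Data.Fin using () renaming (zero to fzero)
open import Data.Fin.Subset using (Subset; _∩_; ∣_∣)
open import Data.Vec using ([]; _∷_; lookup)
open import Data.Product using (Σ; _×_)
open import Data.Sum using (inj₁; inj₂)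
open import Data.Empty using (⊥-elim)
open import Function.Bundles using (_⇔_; mk⇔; Equivalence)
open import Relation.Binary.PropositionalEquality
open import Relation.Nullary using (¬_)
open import Relation.Nullary.Decidable using (does-⇔)

-- For 1 ∉ S, φ complements S inside [2κ_S]. Such a complementation does not
-- change which prefixes [2j] are balanced (|S ∩ [2j]| = j): for j ≤ κ the
-- counts of S and of its flip inside [2j] add up to 2j, and for j ≥ κ they
-- agree because [2κ] itself is balanced. So κ is unchanged, the flip is an
-- involution, and A = B △ [2κ_B]; A cannot contain 1 since φ fixes such sets
-- and B ∉ 𝓕.

∣_∩[_]∣ : ∀ {n} → Subset n → ℕ → ℕ
∣ S ∩[ x ]∣ = ∣ S ∩ prefix x ∣

Balanced : ∀ {n} → Subset n → ℕ → Set
Balanced S κ = ∣ S ∩[ 2 * κ ]∣ ≡ κ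

κ-flip : ∀ {n} → Subset n → Subset n
κ-flip S = S △ prefix (2 * kappa S)

m+n≡2k⇒m≡k⇔n≡k : ∀ {m n k} → m + n ≡ 2 * k → m ≡ k ⇔ n ≡ k
m+n≡2k⇒m≡k⇔n≡k {m} {n} {k} m+n≡2k = mk⇔
  (λ { refl → +-cancelˡ-≡ k n k (trans m+n≡2k k+k) })
  (λ { refl → +-cancelʳ-≡ k m k (trans m+n≡2k k+k) })
  where
  k+k : 2 * k ≡ k + k
  k+k = cong (k +_) (+-identityʳ k)

△-involutiveʳ : ∀ {n} (A P : Subset n) → (A △ P) △ P ≡ A
△-involutiveʳ []      []      = refl
△-involutiveʳ (a ∷ A) (p ∷ P) = cong₂ _∷_ a⊕p⊕p≡a (△-involutiveʳ A P)
  where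
  a⊕p⊕p≡a : (a xor p) xor p ≡ a
  a⊕p⊕p≡a = trans (xor-assoc a p p) (trans (cong (a xor_) (xor-same p)) (xor-identityʳ a))

△-prefix-zero : ∀ {n} (A : Subset n) → A △ prefix 0 ≡ A
△-prefix-zero []      = refl
△-prefix-zero (a ∷ A) = cong₂ _∷_ (xor-identityʳ a) (△-prefix-zero A)

∣∩[0]∣≡0 : ∀ {n} (A : Subset n) → ∣ A ∩[ 0 ]∣ ≡ 0
∣∩[0]∣≡0 []          = refl
∣∩[0]∣≡0 (true ∷ A)  = ∣∩[0]∣≡0 A
∣∩[0]∣≡0 (false ∷ A) = ∣∩[0]∣≡0 A

∣△prefix∩[_]∣-below : ∀ {n} x (A : Subset n) {y} → x ≤ y → x ≤ n →
  ∣ (A △ prefix y) ∩[ x ]∣ + ∣ A ∩[ x ]∣ ≡ x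
∣△prefix∩[_]∣-below zero    A {y}       _         _         =
  cong₂ _+_ (∣∩[0]∣≡0 (A △ prefix y)) (∣∩[0]∣≡0 A)
∣△prefix∩[_]∣-below (suc x) (true ∷ A)  (s≤s x≤y) (s≤s x≤n) =
  trans (+-suc _ _) (cong suc (∣△prefix∩[ x ]∣-below A x≤y x≤n))
∣△prefix∩[_]∣-below (suc x) (false ∷ A) (s≤s x≤y) (s≤s x≤n) =
  cong suc (∣△prefix∩[ x ]∣-below A x≤y x≤n)

∣△prefix∩[_]∣-above : ∀ {n} x (A : Subset n) {y} → y ≤ x →
  ∣ (A △ prefix y) ∩[ x ]∣ + ∣ A ∩[ y ]∣ ≡ ∣ A ∩[ x ]∣ + ∣ (A △ prefix y) ∩[ y ]∣
∣△prefix∩[_]∣-above x       []          _         = refl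
∣△prefix∩[_]∣-above x       A@(_ ∷ _)   {zero} _  =
  cong₂ _+_ (cong ∣_∩[ x ]∣ (△-prefix-zero A))
            (trans (∣∩[0]∣≡0 A) (sym (∣∩[0]∣≡0 (A △ prefix 0))))
∣△prefix∩[_]∣-above (suc x) (true ∷ A)  (s≤s y≤x) =
  trans (+-suc _ _) (cong suc (∣△prefix∩[ x ]∣-above A y≤x))
∣△prefix∩[_]∣-above (suc x) (false ∷ A) (s≤s y≤x) =
  trans (cong suc (∣△prefix∩[ x ]∣-above A y≤x)) (sym (+-suc _ _))

module _ {n} (A : Subset n) {κ} (2κ≤n : 2 * κ ≤ n) (balanced : Balanced A κ) where

  private
    A′ : Subset n
    A′ = A △ prefix (2 * κ)

  balanced-△prefix : Balanced A′ κ
  balanced-△prefix = Equivalence.from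
    (m+n≡2k⇒m≡k⇔n≡k (∣△prefix∩[ 2 * κ ]∣-below A ≤-refl 2κ≤n)) balanced

  balanced-△prefix⇔ : ∀ k → Balanced A′ k ⇔ Balanced A k
  balanced-△prefix⇔ k with ≤-total k κ
  ... | inj₁ k≤κ = m+n≡2k⇒m≡k⇔n≡k (∣△prefix∩[ 2 * k ]∣-below A 2k≤2κ (≤-trans 2k≤2κ 2κ≤n))
    where
    2k≤2κ : 2 * k ≤ 2 * κ
    2k≤2κ = *-monoʳ-≤ 2 k≤κ
  ... | inj₂ κ≤k = mk⇔ (trans (sym same-count)) (trans same-count)
    where
    same-count : ∣ A′ ∩[ 2 * k ]∣ ≡ ∣ A ∩[ 2 * k ]∣
    same-count = +-cancelʳ-≡ κ _ _ (begin
      ∣ A′ ∩[ 2 * k ]∣ + κ                 ≡⟨ cong (∣ A′ ∩[ 2 * k ]∣ +_) balanced ⟨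
      ∣ A′ ∩[ 2 * k ]∣ + ∣ A ∩[ 2 * κ ]∣   ≡⟨ ∣△prefix∩[ 2 * k ]∣-above A (*-monoʳ-≤ 2 κ≤k) ⟩
      ∣ A ∩[ 2 * k ]∣ + ∣ A′ ∩[ 2 * κ ]∣   ≡⟨ cong (∣ A ∩[ 2 * k ]∣ +_) balanced-△prefix ⟩
      ∣ A ∩[ 2 * k ]∣ + κ                  ∎)
      where open ≡-Reasoning

kappaFrom-≤ : ∀ {n} (S : Subset n) k → kappaFrom S k ≤ k
kappaFrom-≤ S zero    = z≤n
kappaFrom-≤ S (suc k) with ∣ S ∩ prefix (2 * suc k) ∣ ≡ᵇ suc k
... | true  = ≤-refl
... | false = m≤n⇒m≤1+n (kappaFrom-≤ S k)

kappaFrom-balanced : ∀ {n} (S : Subset n) k → Balanced S (kappaFrom S k)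
kappaFrom-balanced S zero    = ∣∩[0]∣≡0 S
kappaFrom-balanced S (suc k)
  with ∣ S ∩ prefix (2 * suc k) ∣ ≡ᵇ suc k | ≡ᵇ⇒≡ ∣ S ∩ prefix (2 * suc k) ∣ (suc k)
... | true  | balanced = balanced _
... | false | _        = kappaFrom-balanced S k

kappaFrom-cong : ∀ {n} {S T : Subset n} → (∀ k → Balanced S k ⇔ Balanced T k) →
  ∀ k → kappaFrom S k ≡ kappaFrom T k
kappaFrom-cong S⇔T zero    = refl
kappaFrom-cong S⇔T (suc k) = cong₂ (λ b κ → if b then suc k else κ)
  (does-⇔ (S⇔T (suc k)) (_ ≟ _) (_ ≟ _)) (kappaFrom-cong S⇔T k)

2*kappa≤n : ∀ {n} (S : Subset n) → 2 * kappa S ≤ n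
2*kappa≤n {n} S = ≤-trans (*-monoʳ-≤ 2 (kappaFrom-≤ S (n / 2)))
  (subst (_≤ n) (*-comm (n / 2) 2) (m/n*n≤m n 2))

kappa-κ-flip : ∀ {n} (S : Subset n) → kappa (κ-flip S) ≡ kappa S
kappa-κ-flip {n} S = kappaFrom-cong
  (balanced-△prefix⇔ S (2*kappa≤n S) (kappaFrom-balanced S (n / 2))) (n / 2)

κ-flip-involutive : ∀ {n} (S : Subset n) → κ-flip (κ-flip S) ≡ S
κ-flip-involutive S = begin
  κ-flip S △ prefix (2 * kappa (κ-flip S)) ≡⟨ cong (λ κ → κ-flip S △ prefix (2 * κ)) (kappa-κ-flip S) ⟩
  (S △ prefix (2 * kappa S)) △ prefix (2 * kappa S) ≡⟨ △-involutiveʳ S _ ⟩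
  S ∎
  where open ≡-Reasoning

proposition6 : (m r : ℕ) → 1 ≤ r → 2 * r ≤ suc m →
    (𝓕 : Family (suc m)) → Uniform r 𝓕 → Shifted 𝓕 → Intersecting 𝓕 →
    (B : Subset (suc m)) →
    Σ (Subset (suc m)) (λ A → 𝓕 A × phi A ≡ B) → ¬ 𝓕 B →
    (A : Subset (suc m)) → 𝓕 A → phi A ≡ B → A ≡ B △ prefix (2 * kappa B)
proposition6 m r _ _ 𝓕 _ _ _ B _ B∉𝓕 A A∈𝓕 φA≡B with lookup A fzero
... | true  = ⊥-elim (B∉𝓕 (subst 𝓕 φA≡B A∈𝓕))
... | false = subst (λ B → A ≡ κ-flip B) φA≡B (sym (κ-flip-involutive A))
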